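{- Let $G$ be a finite abelian group (written additively, identity $0$) and let $S,T,U\subseteq G\setminus\{0\}$ be symmetric subsets with $A(G;U)=A(G;S)A(G;T)$. Then $(S-S)\cap(T-T)=\{0\}$.
   Context: A subset $X$ is symmetric if $-X=X$. Fix an enumeration $G=\{g_1,\dots,g_n\}$; $A(G;X)$ is the $n\times n$ matrix with $(i,j)$ entry $1$ if $g_j-g_i\in X$ and $0$ otherwise. $X-X=\{x-x':x,x'\in X\}$. -}

module Defs where

open import Level using (Level; _⊔_)
open import Data.Nat using (ℕ; zero; suc; _+_; _*_)
open import Data.Fin using (Fin; zero; suc)
open import Data.Product using (Σ; _×_; ∃; _,_)
open import Data.Bool using (if_then_else_)
open import Relation.Binary.PropositionalEquality using (_≡_)
open import Relation.Nullary using (¬_; Dec)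
open import Relation.Nullary.Decidable using (⌊_⌋)
open import Relation.Unary using (Pred; Decidable)
open import Algebra.Bundles using (AbelianGroup)

∑ : (n : ℕ) → (Fin n → ℕ) → ℕ
∑ zero    f = 0
∑ (suc n) f = f zero + ∑ n (λ i → f (suc i))

_⊗_ : {n : ℕ} → (Fin n → Fin n → ℕ) → (Fin n → Fin n → ℕ) → (Fin n → Fin n → ℕ)
(M ⊗ N) i j = ∑ _ (λ k → M i k * N k j)

module _ {c ℓ : Level} (G : AbelianGroup c ℓ) where
  open AbelianGroup G renaming (Carrier to A)

  0G : A
  0G = ε

  neg : A → A
  neg x = x ⁻¹

  _−_ : A → A → A
  x − y = x ∙ (y ⁻¹)

  record Enumeration (n : ℕ) : Set (c ⊔ ℓ) where
    field
      g          : Fin n → A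
      injective  : ∀ i j → g i ≈ g j → i ≡ j
      surjective : ∀ x → Σ (Fin n) (λ i → g i ≈ x)

  -- finite abelian group: admits an enumeration by some Fin n
  -- (stated directly in the theorem by quantifying over n and an Enumeration)

  AvoidsZero : ∀ {p} → Pred A p → Set (c ⊔ ℓ ⊔ p)
  AvoidsZero X = ∀ x → X x → ¬ (x ≈ 0G)

  Symmetric : ∀ {p} → Pred A p → Set (c ⊔ p)
  Symmetric X = ∀ x → X x → X (neg x)

  -- X respects the group's equality (so X is a genuine subset of the setoid G)
  Respects : ∀ {p} → Pred A p → Set (c ⊔ ℓ ⊔ p)
  Respects X = ∀ {x y} → x ≈ y → X x → X y

  Diff : ∀ {p} → Pred A p → Pred A (c ⊔ ℓ ⊔ p)
  Diff X z = ∃ λ x → ∃ λ x' → X x × X x' × (z ≈ x − x')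

  adjMat : ∀ {n p} → Enumeration n → (X : Pred A p) → Decidable X → Fin n → Fin n → ℕ
  adjMat e X X? i j = if ⌊ X? (g j − g i) ⌋ then 1 else 0
    where open Enumeration e

{-# OPTIONS --safe #-}
-- Entry (i, j) of A(G;S) A(G;T) counts the k with g_k − g_i ∈ S and g_j − g_k ∈ T, i.e.
-- the decompositions g_j − g_i = s + t with s ∈ S, t ∈ T.  If the product is a 0/1 matrix
-- (as A(G;U) is), every element has at most one such decomposition.  But z = s₁ − s₂ = t₁ − t₂
-- gives the two decompositions s₁ + t₂ = s₂ + t₁, so s₁ = s₂ and z = 0.
module Submission where

open import Defs
open import Level using (Level)
open import Data.Nat using (ℕ; _≤_; _<_; s≤s; z≤n)
open import Data.Nat.Properties using (≤-trans; m≤m+n; m≤n+m; +-mono-≤; *-mono-≤; <-irrefl)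
open import Data.Fin using (Fin; zero; suc)
open import Data.Product using (_,_; proj₁; proj₂)
open import Data.Bool using (if_then_else_)
open import Data.Empty using (⊥-elim)
open import Relation.Binary.PropositionalEquality as ≡ using (_≡_)
open import Relation.Nullary using (Dec; yes; no)
open import Relation.Nullary.Decidable using (⌊_⌋)
open import Relation.Unary using (Pred; Decidable)
open import Algebra.Bundles using (AbelianGroup; module Group)
import Algebra.Properties.AbelianGroup as AbelianGroupProperties
import Relation.Binary.Reasoning.Setoid as SetoidReasoning

term≤∑ : ∀ {n} (f : Fin n → ℕ) k → f k ≤ ∑ n f
term≤∑ f zero    = m≤m+n _ _
term≤∑ f (suc k) = ≤-trans (term≤∑ (λ i → f (suc i)) k) (m≤n+m _ (f zero))

∑≤1⇒unique-positive : ∀ {n} (f : Fin n → ℕ) {k k′} →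
                      ∑ n f ≤ 1 → 0 < f k → 0 < f k′ → k ≡ k′
∑≤1⇒unique-positive f {zero}  {zero}   _   _     _      = ≡.refl
∑≤1⇒unique-positive f {zero}  {suc k′} ∑≤1 0<fk  0<fk′  =
  ⊥-elim (<-irrefl ≡.refl (≤-trans (+-mono-≤ 0<fk (≤-trans 0<fk′ (term≤∑ _ k′))) ∑≤1))
∑≤1⇒unique-positive f {suc k} {zero}   ∑≤1 0<fk  0<fk′  =
  ⊥-elim (<-irrefl ≡.refl (≤-trans (+-mono-≤ 0<fk′ (≤-trans 0<fk (term≤∑ _ k))) ∑≤1))
∑≤1⇒unique-positive f {suc k} {suc k′} ∑≤1 0<fk  0<fk′  =
  ≡.cong suc (∑≤1⇒unique-positive _ (≤-trans (m≤n+m _ (f zero)) ∑≤1) 0<fk 0<fk′)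

⊗≤1⇒unique-middle : ∀ {n} (M N : Fin n → Fin n → ℕ) {i j k k′} → (M ⊗ N) i j ≤ 1 →
                    0 < M i k → 0 < N k j → 0 < M i k′ → 0 < N k′ j → k ≡ k′
⊗≤1⇒unique-middle M N ⊗≤1 0<Mik 0<Nkj 0<Mik′ 0<Nk′j =
  ∑≤1⇒unique-positive _ ⊗≤1 (*-mono-≤ 0<Mik 0<Nkj) (*-mono-≤ 0<Mik′ 0<Nk′j)

indicator≤1 : ∀ {a} {X : Set a} (X? : Dec X) → (if ⌊ X? ⌋ then 1 else 0) ≤ 1
indicator≤1 (yes _) = s≤s z≤n
indicator≤1 (no _)  = z≤n

indicator>0 : ∀ {a} {X : Set a} (X? : Dec X) → X → 0 < (if ⌊ X? ⌋ then 1 else 0)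
indicator>0 (yes _) _ = s≤s z≤n
indicator>0 (no ¬x) x = ⊥-elim (¬x x)

module _ {c ℓ : Level} (G : AbelianGroup c ℓ) where
  open AbelianGroup G renaming (Carrier to A)
  open Group group using (_//_)
  open AbelianGroupProperties G using (ε⁻¹≈ε; xyx⁻¹≈y; //-cong₂; //-rightDividesˡ)
  open SetoidReasoning setoid

  x//ε≈x : ∀ x → x // ε ≈ x
  x//ε≈x x = trans (∙-congˡ ε⁻¹≈ε) (identityʳ x)

  x//y≈u//v⇒x∙v≈y∙u : ∀ {x y u v} → x // y ≈ u // v → x ∙ v ≈ y ∙ u
  x//y≈u//v⇒x∙v≈y∙u {x} {y} {u} {v} x//y≈u//v = begin
    x ∙ v              ≈⟨ ∙-congʳ (//-rightDividesˡ y x) ⟨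
    (x // y) ∙ y ∙ v   ≈⟨ ∙-congʳ (∙-congʳ x//y≈u//v) ⟩
    (u // v) ∙ y ∙ v   ≈⟨ ∙-congʳ (comm (u // v) y) ⟩
    y ∙ (u // v) ∙ v   ≈⟨ assoc y (u // v) v ⟩
    y ∙ ((u // v) ∙ v) ≈⟨ ∙-congˡ (//-rightDividesˡ v u) ⟩
    y ∙ u              ∎

  module _ {n : ℕ} (e : Enumeration G n) where
    open Enumeration e

    index : A → Fin n
    index x = proj₁ (surjective x)

    g∘index≈id : ∀ x → g (index x) ≈ x
    g∘index≈id x = proj₂ (surjective x)

    adjMat≤1 : ∀ {p} (X : Pred A p) (X? : Decidable X) i j → adjMat G e X X? i j ≤ 1
    adjMat≤1 X X? i j = indicator≤1 (X? _)

    adjMat-index>0 : ∀ {p} {X : Pred A p} (X? : Decidable X) → Respects G X →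
                     ∀ {x y} → X (y // x) → 0 < adjMat G e X X? (index x) (index y)
    adjMat-index>0 X? respects {x} {y} y//x∈X =
      indicator>0 (X? _) (respects (sym (//-cong₂ (g∘index≈id y) (g∘index≈id x))) y//x∈X)

    ⊗≤1⇒sum-injective : ∀ {p} {S T : Pred A p} (S? : Decidable S) (T? : Decidable T) →
                        Respects G S → Respects G T →
                        (∀ i j → (adjMat G e S S? ⊗ adjMat G e T T?) i j ≤ 1) →
                        ∀ {s t s′ t′} → S s → T t → S s′ → T t′ → s ∙ t ≈ s′ ∙ t′ → s ≈ s′
    ⊗≤1⇒sum-injective {S = S} {T} S? T? respectsS respectsT ⊗≤1 {s} {t} {s′} {t′}
                      s∈S t∈T s′∈S t′∈T s∙t≈s′∙t′ = begin
      s               ≈⟨ g∘index≈id s ⟨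
      g (index s)     ≡⟨ ≡.cong g index-s≡index-s′ ⟩
      g (index s′)    ≈⟨ g∘index≈id s′ ⟩
      s′              ∎
      where
      from-ε : ∀ {x} → S x → S (x // ε)
      from-ε x∈S = respectsS (sym (x//ε≈x _)) x∈S

      to-s∙t : ∀ {x y} → T y → x ∙ y ≈ s ∙ t → T ((s ∙ t) // x)
      to-s∙t {x} {y} y∈T x∙y≈s∙t =
        respectsT (trans (sym (xyx⁻¹≈y x y)) (∙-congʳ x∙y≈s∙t)) y∈T

      index-s≡index-s′ : index s ≡ index s′
      index-s≡index-s′ =
        ⊗≤1⇒unique-middle (adjMat G e S S?) (adjMat G e T T?) (⊗≤1 (index ε) (index (s ∙ t)))
        (adjMat-index>0 S? respectsS (from-ε s∈S))
        (adjMat-index>0 T? respectsT (to-s∙t t∈T refl))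
        (adjMat-index>0 S? respectsS (from-ε s′∈S))
        (adjMat-index>0 T? respectsT (to-s∙t t′∈T (sym s∙t≈s′∙t′)))

mainTheorem12 : {c ℓ p : Level} (G : AbelianGroup c ℓ) (n : ℕ) (e : Enumeration G n)
    (S T U : Pred (AbelianGroup.Carrier G) p)
    (S? : Decidable S) (T? : Decidable T) (U? : Decidable U) →
    Respects G S → Respects G T → Respects G U →
    Symmetric G S → Symmetric G T → Symmetric G U →
    AvoidsZero G S → AvoidsZero G T → AvoidsZero G U →
    (∀ i j → adjMat G e U U? i j ≡ (adjMat G e S S? ⊗ adjMat G e T T?) i j) →
    ∀ z → Diff G S z → Diff G T z → AbelianGroup._≈_ G z (AbelianGroup.ε G)
mainTheorem12 G n e S T U S? T? U? respectsS respectsT _ _ _ _ _ _ _ A[U]≡A[S]A[T]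
  z (s₁ , s₂ , s₁∈S , s₂∈S , z≈s₁-s₂) (t₁ , t₂ , t₁∈T , t₂∈T , z≈t₁-t₂) =
  trans z≈s₁-s₂ (x≈y⇒x∙y⁻¹≈ε s₁≈s₂)
  where
  open AbelianGroup G
  open AbelianGroupProperties G using (x≈y⇒x∙y⁻¹≈ε)

  A[S]A[T]≤1 : ∀ i j → (adjMat G e S S? ⊗ adjMat G e T T?) i j ≤ 1
  A[S]A[T]≤1 i j = ≡.subst (_≤ 1) (A[U]≡A[S]A[T] i j) (adjMat≤1 G e U U? i j)

  s₁≈s₂ : s₁ ≈ s₂
  s₁≈s₂ = ⊗≤1⇒sum-injective G e S? T? respectsS respectsT A[S]A[T]≤1 s₁∈S t₂∈T s₂∈S t₁∈T
    (x//y≈u//v⇒x∙v≈y∙u G (trans (sym z≈s₁-s₂) z≈t₁-t₂))
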